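{- Let $\underline{R}$ be an arbitrary computation type of EEC. For all simply-typed $\lambda$-terms with $\Theta\vdash M:\tau$ and $\Theta\vdash N:\tau$: if $\Theta\vdash M=_{\lambda_c}N:\tau$, then in EEC $$\Theta^{lv}\mid -\vdash M^{lv}=N^{lv}:(\tau^{lv}\Rightarrow\underline{R})\multimap\underline{R}.$$
   Context: **EEC (enriched effect calculus).** There are value-type constants $\alpha,\beta,\ldots$ and a disjoint set of computation-type constants $\underline{\alpha},\underline{\beta},\ldots$. Value types $A,B,C$ and computation types $\underline{A},\underline{B},\underline{C},\underline{D}$ are generated by $A::=\alpha\mid 1\mid A\times B\mid A\to B\mid \underline{A}\mid \underline{A}\multimap\underline{B}$ and $\underline{A}::=\underline{\alpha}\mid\underline{1}\mid\underline{A}\,\&\,\underline{B}\mid A\Rightarrow\underline{B}\mid\underline{I}\mid\ !A\mid\ !A\otimes\underline{B}\mid\underline{0}\mid\underline{A}\oplus\underline{B}$ (every computation type is also a value type; $!A\otimes\underline{B}$ is one primitive binary constructor). Judgements are $\Gamma\mid -\vdash t:A$ and $\Gamma\mid z{:}\underline{A}\vdash t:\underline{B}$, where $\Gamma$ lists distinct variables with value types and the "stoup" holds at most one variable, of computation type; with nonempty stoup the result type is a computation type. Below $\Delta$ is empty or $z{:}\underline{D}$. Typing rules: $\Gamma,x{:}A\mid-\vdash x:A$; $\Gamma\mid-\vdash *:1$; pairs $\langle t,u\rangle:A\times B$, projections $\pi_1t,\pi_2t$; $\lambda x{:}A.t:A\to B$ from $\Gamma,x{:}A\mid-\vdash t:B$;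 application $t\,u$ (all with empty stoup). $\Gamma\mid z{:}\underline A\vdash z:\underline A$; $\Gamma\mid\Delta\vdash\underline{*}:\underline 1$; from $\Gamma\mid\Delta\vdash t:\underline A$, $\Gamma\mid\Delta\vdash u:\underline B$ get $\Gamma\mid\Delta\vdash\langle t,u\rangle_c:\underline A\,\&\,\underline B$, and from $\Gamma\mid\Delta\vdash t:\underline A\,\&\,\underline B$ get $\underline\pi_1t:\underline A$, $\underline\pi_2t:\underline B$; from $\Gamma,x{:}A\mid\Delta\vdash t:\underline B$ get $\Gamma\mid\Delta\vdash\underline\lambda x{:}A.t:A\Rightarrow\underline B$; from $\Gamma\mid\Delta\vdash s:A\Rightarrow\underline B$, $\Gamma\mid-\vdash t:A$ get $\Gamma\mid\Delta\vdash s@t:\underline B$; $\Gamma\mid-\vdash\top:\underline I$; from $\Gamma\mid\Delta\vdash t:\underline I$, $\Gamma\mid-\vdash u:\underline A$ get $\Gamma\mid\Delta\vdash \mathrm{let}\ \top\ \mathrm{be}\ t\ \mathrm{in}\ u:\underline A$; from $\Gamma\mid-\vdash t:A$ get $\Gamma\mid-\vdash\,!t:\,!A$; from $\Gamma\mid\Delta\vdash t:\,!A$, $\Gamma,x{:}A\mid-\vdash u:\underline B$ get $\Gamma\mid\Delta\vdash\mathrm{let}\ !x\ \mathrm{be}\ t\ \mathrm{in}\ u:\underline B$; from $\Gamma\mid-\vdash t:A$, $\Gamma\mid\Delta\vdash u:\underline B$ get $\Gamma\mid\Delta\vdash\,!t\otimes u:\,!A\otimes\underline B$; from $\Gamma\mid\Delta\vdash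 s:\,!A\otimes\underline B$, $\Gamma,x{:}A\mid y{:}\underline B\vdash t:\underline C$ get $\Gamma\mid\Delta\vdash\mathrm{let}\ !x\otimes y\ \mathrm{be}\ s\ \mathrm{in}\ t:\underline C$; from $\Gamma\mid\Delta\vdash t:\underline 0$ get $\Gamma\mid\Delta\vdash\mathrm{abort}_{\underline A}(t):\underline A$; $\mathrm{inl}\,t:\underline A\oplus\underline B$ from $t:\underline A$ and $\mathrm{inr}\,t$ from $t:\underline B$ (same $\Gamma\mid\Delta$); from $\Gamma\mid\Delta\vdash s:\underline A\oplus\underline B$, $\Gamma\mid x{:}\underline A\vdash t:\underline C$, $\Gamma\mid y{:}\underline B\vdash u:\underline C$ get $\Gamma\mid\Delta\vdash\mathrm{case}\ s\ \mathrm{of}\ (\mathrm{inl}\,x\Rightarrow t\mid\mathrm{inr}\,y\Rightarrow u):\underline C$; from $\Gamma\mid z{:}\underline A\vdash t:\underline B$ get $\Gamma\mid-\vdash\hat\lambda z{:}\underline A.t:\underline A\multimap\underline B$; from $\Gamma\mid-\vdash s:\underline A\multimap\underline B$, $\Gamma\mid\Delta\vdash t:\underline A$ get $\Gamma\mid\Delta\vdash s\{t\}:\underline B$. Equality $\Gamma\mid\Delta\vdash t=u:A$ is the least typed congruence (equivalence, compatible with all term formers, containing $\alpha$-equivalence) containing all well-typed instances of: $t=*$ for $t:1$; $\pi_1\langle t,u\rangle=t$, $\pi_2\langle t,u\rangle=u$, $\langle\pi_1t,\pi_2t\rangle=t$; $(\lambda x.t)u=t[u/x]$, $\lambda x.(t\,x)=t$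 ($x$ not free in $t$); $t=\underline*$ for $t:\underline1$; $\underline\pi_1\langle t,u\rangle_c=t$, $\underline\pi_2\langle t,u\rangle_c=u$, $\langle\underline\pi_1t,\underline\pi_2t\rangle_c=t$; $(\underline\lambda x.t)@u=t[u/x]$, $\underline\lambda x.(t@x)=t$ ($x$ not free); $\mathrm{let}\ \top\ \mathrm{be}\ \top\ \mathrm{in}\ t=t$; $\mathrm{let}\ \top\ \mathrm{be}\ t\ \mathrm{in}\ u[\top/x]=u[t/x]$ for $\Gamma\mid x{:}\underline I\vdash u:\underline A$; $\mathrm{let}\ !x\ \mathrm{be}\ !t\ \mathrm{in}\ u=u[t/x]$; $\mathrm{let}\ !x\ \mathrm{be}\ t\ \mathrm{in}\ u[!x/y]=u[t/y]$ for $\Gamma\mid y{:}\,!A\vdash u:\underline B$; $\mathrm{let}\ !x\otimes y\ \mathrm{be}\ !t\otimes s\ \mathrm{in}\ u=u[t/x,s/y]$; $\mathrm{let}\ !x\otimes y\ \mathrm{be}\ t\ \mathrm{in}\ u[(!x\otimes y)/z]=u[t/z]$ for $\Gamma\mid z{:}\,!A\otimes\underline B\vdash u:\underline C$; $\mathrm{abort}_{\underline A}(t)=u[t/x]$ for $\Gamma\mid x{:}\underline 0\vdash u:\underline A$; $\mathrm{case}\ \mathrm{inl}\,t\ \mathrm{of}\ (\mathrm{inl}\,x\Rightarrow u\mid\mathrm{inr}\,y\Rightarrow u')=u[t/x]$ and symmetrically for $\mathrm{inr}$; $\mathrm{case}\ t\ \mathrm{of}\ (\mathrm{inl}\,x\Rightarrow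 u[\mathrm{inl}\,x/z]\mid\mathrm{inr}\,y\Rightarrow u[\mathrm{inr}\,y/z])=u[t/z]$ for $\Gamma\mid z{:}\underline A\oplus\underline B\vdash u:\underline C$; $(\hat\lambda x.t)\{u\}=t[u/x]$, $\hat\lambda x.(t\{x\})=t$ ($x$ not free). **Simply-typed $\lambda$-calculus.** Types $\sigma,\tau::=\alpha\mid 1\mid\sigma\times\tau\mid\sigma\to\tau$; terms $x,*,\langle M,N\rangle,\pi_1M,\pi_2M,\lambda x{:}\sigma.M,M\,N$ with the standard typing in contexts $\Theta=x_1{:}\sigma_1,\ldots,x_n{:}\sigma_n$. $=_{\lambda_c}$ is the equational theory of Moggi's computational $\lambda$-calculus $\lambda_c$. Each $\lambda$-calculus type constant $\alpha$ is also an EEC value-type constant. **Linear-use cbv CPS translation** (relative to $\underline R$): $\alpha^{lv}=\alpha$, $1^{lv}=1$, $(\sigma\times\tau)^{lv}=\sigma^{lv}\times\tau^{lv}$, $(\sigma\to\tau)^{lv}=\sigma^{lv}\to((\tau^{lv}\Rightarrow\underline R)\multimap\underline R)$; $\Theta^{lv}=x_1{:}\sigma_1^{lv},\ldots$. A judgement $\Theta\vdash M:\tau$ is sent to $\Theta^{lv}\mid-\vdash M^{lv}:(\tau^{lv}\Rightarrow\underline R)\multimap\underline R$ where: $x^{lv}=\hat\lambda k{:}\sigma^{lv}\Rightarrow\underline R.\,k@x$; $*^{lv}=\hat\lambda k{:}1\Rightarrow\underline R.\,k@*$; $\langle M,N\rangle^{lv}=\hat\lambda k{:}(\sigma^{lv}\times\tau^{lv})\Rightarrow\underline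 R.\,M^{lv}\{\underline\lambda x{:}\sigma^{lv}.\,N^{lv}\{\underline\lambda y{:}\tau^{lv}.\,k@\langle x,y\rangle\}\}$; $(\pi_1M)^{lv}=\hat\lambda k{:}\sigma^{lv}\Rightarrow\underline R.\,M^{lv}\{\underline\lambda z{:}\sigma^{lv}\times\tau^{lv}.\,k@(\pi_1z)\}$ and $(\pi_2M)^{lv}$ analogously with $\tau^{lv}$, $\pi_2$; $(\lambda x{:}\sigma.M)^{lv}=\hat\lambda k{:}(\sigma\to\tau)^{lv}\Rightarrow\underline R.\,k@(\lambda x{:}\sigma^{lv}.M^{lv})$; for $M:\sigma\to\tau$, $N:\sigma$: $(M\,N)^{lv}=\hat\lambda k{:}\tau^{lv}\Rightarrow\underline R.\,M^{lv}\{\underline\lambda f{:}(\sigma\to\tau)^{lv}.\,N^{lv}\{\underline\lambda x{:}\sigma^{lv}.\,(f\,x)\{k\}\}\}$. -}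

module Defs where

open import Data.Nat using (ℕ)
open import Data.List using (List; []; _∷_; map)
open import Data.Maybe using (Maybe; nothing; just)

infix 4 _∋_
data _∋_ {T : Set} : List T → T → Set where
  Z  : ∀ {Γ A} → (A ∷ Γ) ∋ A
  S_ : ∀ {Γ A B} → Γ ∋ A → (B ∷ Γ) ∋ A

-- EEC types.  Value-type constants and computation-type constants are
-- indexed by ℕ (two disjoint families).  `U C` is the inclusion of the
-- computation type C into the value types.

mutual
  data VTy : Set where
    vα    : ℕ → VTy
    v1    : VTy
    _v×_  : VTy → VTy → VTy
    _v→_  : VTy → VTy → VTy
    U     : CTy → VTy
    _⊸_   : CTy → CTy → VTy

  data CTy : Set where
    cα    : ℕ → CTy
    c1    : CTy
    _&_   : CTy → CTy → CTy
    _⇒_   : VTy → CTy → CTy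
    cI    : CTy
    !_    : VTy → CTy
    !_⊗_  : VTy → CTy → CTy
    c0    : CTy
    _⊕_   : CTy → CTy → CTy

Ctx : Set
Ctx = List VTy

-- the stoup: empty, or a single (anonymous, de Bruijn) variable of
-- computation type
Stoup : Set
Stoup = Maybe CTy

-- EEC terms, intrinsically typed:  Tm Γ Δ A  is  Γ | Δ ⊢ t : A.

data Tm (Γ : Ctx) : Stoup → VTy → Set where
  var   : ∀ {A} → Γ ∋ A → Tm Γ nothing A
  unit  : Tm Γ nothing v1
  pair  : ∀ {A B} → Tm Γ nothing A → Tm Γ nothing B → Tm Γ nothing (A v× B)
  fst   : ∀ {A B} → Tm Γ nothing (A v× B) → Tm Γ nothing A
  snd   : ∀ {A B} → Tm Γ nothing (A v× B) → Tm Γ nothing B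
  lam   : ∀ {A B} → Tm (A ∷ Γ) nothing B → Tm Γ nothing (A v→ B)
  app   : ∀ {A B} → Tm Γ nothing (A v→ B) → Tm Γ nothing A → Tm Γ nothing B
  svar  : ∀ {C} → Tm Γ (just C) (U C)
  cunit : ∀ {Δ} → Tm Γ Δ (U c1)
  cpair : ∀ {Δ C D} → Tm Γ Δ (U C) → Tm Γ Δ (U D) → Tm Γ Δ (U (C & D))
  cfst  : ∀ {Δ C D} → Tm Γ Δ (U (C & D)) → Tm Γ Δ (U C)
  csnd  : ∀ {Δ C D} → Tm Γ Δ (U (C & D)) → Tm Γ Δ (U D)
  clam  : ∀ {Δ A D} → Tm (A ∷ Γ) Δ (U D) → Tm Γ Δ (U (A ⇒ D))
  capp  : ∀ {Δ A D} → Tm Γ Δ (U (A ⇒ D)) → Tm Γ nothing A → Tm Γ Δ (U D)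
  top   : Tm Γ nothing (U cI)
  letTop : ∀ {Δ C} → Tm Γ Δ (U cI) → Tm Γ nothing (U C) → Tm Γ Δ (U C)
  bang  : ∀ {A} → Tm Γ nothing A → Tm Γ nothing (U (! A))
  letBang : ∀ {Δ A D} → Tm Γ Δ (U (! A)) → Tm (A ∷ Γ) nothing (U D) → Tm Γ Δ (U D)
  tensor : ∀ {Δ A D} → Tm Γ nothing A → Tm Γ Δ (U D) → Tm Γ Δ (U (! A ⊗ D))
  letTensor : ∀ {Δ A D C} → Tm Γ Δ (U (! A ⊗ D)) → Tm (A ∷ Γ) (just D) (U C)
            → Tm Γ Δ (U C)
  abort : ∀ {Δ} (C : CTy) → Tm Γ Δ (U c0) → Tm Γ Δ (U C)
  inl   : ∀ {Δ C D} → Tm Γ Δ (U C) → Tm Γ Δ (U (C ⊕ D))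
  inr   : ∀ {Δ C D} → Tm Γ Δ (U D) → Tm Γ Δ (U (C ⊕ D))
  case  : ∀ {Δ C D E} → Tm Γ Δ (U (C ⊕ D)) → Tm Γ (just C) (U E) → Tm Γ (just D) (U E)
        → Tm Γ Δ (U E)
  hlam  : ∀ {C D} → Tm Γ (just C) (U D) → Tm Γ nothing (C ⊸ D)
  happ  : ∀ {Δ C D} → Tm Γ nothing (C ⊸ D) → Tm Γ Δ (U C) → Tm Γ Δ (U D)

Ren : Ctx → Ctx → Set
Ren Γ Γ' = ∀ {A} → Γ ∋ A → Γ' ∋ A

extR : ∀ {Γ Γ' B} → Ren Γ Γ' → Ren (B ∷ Γ) (B ∷ Γ')
extR ρ Z     = Z
extR ρ (S x) = S (ρ x)

rename : ∀ {Γ Γ' Δ A} → Ren Γ Γ' → Tm Γ Δ A → Tm Γ' Δ A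
rename ρ (var x) = var (ρ x)
rename ρ unit = unit
rename ρ (pair t u) = pair (rename ρ t) (rename ρ u)
rename ρ (fst t) = fst (rename ρ t)
rename ρ (snd t) = snd (rename ρ t)
rename ρ (lam t) = lam (rename (extR ρ) t)
rename ρ (app t u) = app (rename ρ t) (rename ρ u)
rename ρ svar = svar
rename ρ cunit = cunit
rename ρ (cpair t u) = cpair (rename ρ t) (rename ρ u)
rename ρ (cfst t) = cfst (rename ρ t)
rename ρ (csnd t) = csnd (rename ρ t)
rename ρ (clam t) = clam (rename (extR ρ) t)
rename ρ (capp t u) = capp (rename ρ t) (rename ρ u)
rename ρ top = top
rename ρ (letTop t u) = letTop (rename ρ t) (rename ρ u)
rename ρ (bang t) = bang (rename ρ t)
rename ρ (letBang t u) = letBang (rename ρ t) (rename (extR ρ) u)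
rename ρ (tensor t u) = tensor (rename ρ t) (rename ρ u)
rename ρ (letTensor t u) = letTensor (rename ρ t) (rename (extR ρ) u)
rename ρ (abort C t) = abort C (rename ρ t)
rename ρ (inl t) = inl (rename ρ t)
rename ρ (inr t) = inr (rename ρ t)
rename ρ (case s t u) = case (rename ρ s) (rename ρ t) (rename ρ u)
rename ρ (hlam t) = hlam (rename ρ t)
rename ρ (happ t u) = happ (rename ρ t) (rename ρ u)

wk : ∀ {Γ Δ A B} → Tm Γ Δ A → Tm (B ∷ Γ) Δ A
wk = rename S_

Sub : Ctx → Ctx → Set
Sub Γ Γ' = ∀ {A} → Γ ∋ A → Tm Γ' nothing A

extS : ∀ {Γ Γ' B} → Sub Γ Γ' → Sub (B ∷ Γ) (B ∷ Γ')
extS σ Z     = var Z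
extS σ (S x) = wk (σ x)

subst : ∀ {Γ Γ' Δ A} → Sub Γ Γ' → Tm Γ Δ A → Tm Γ' Δ A
subst σ (var x) = σ x
subst σ unit = unit
subst σ (pair t u) = pair (subst σ t) (subst σ u)
subst σ (fst t) = fst (subst σ t)
subst σ (snd t) = snd (subst σ t)
subst σ (lam t) = lam (subst (extS σ) t)
subst σ (app t u) = app (subst σ t) (subst σ u)
subst σ svar = svar
subst σ cunit = cunit
subst σ (cpair t u) = cpair (subst σ t) (subst σ u)
subst σ (cfst t) = cfst (subst σ t)
subst σ (csnd t) = csnd (subst σ t)
subst σ (clam t) = clam (subst (extS σ) t)
subst σ (capp t u) = capp (subst σ t) (subst σ u)
subst σ top = top
subst σ (letTop t u) = letTop (subst σ t) (subst σ u)
subst σ (bang t) = bang (subst σ t)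
subst σ (letBang t u) = letBang (subst σ t) (subst (extS σ) u)
subst σ (tensor t u) = tensor (subst σ t) (subst σ u)
subst σ (letTensor t u) = letTensor (subst σ t) (subst (extS σ) u)
subst σ (abort C t) = abort C (subst σ t)
subst σ (inl t) = inl (subst σ t)
subst σ (inr t) = inr (subst σ t)
subst σ (case s t u) = case (subst σ s) (subst σ t) (subst σ u)
subst σ (hlam t) = hlam (subst σ t)
subst σ (happ t u) = happ (subst σ t) (subst σ u)

sub0 : ∀ {Γ A} → Tm Γ nothing A → Sub (A ∷ Γ) Γ
sub0 u Z     = u
sub0 u (S x) = var x

_[_] : ∀ {Γ Δ A B} → Tm (A ∷ Γ) Δ B → Tm Γ nothing A → Tm Γ Δ B
t [ u ] = subst (sub0 u) t

-- linear substitution  u[t/z]  for the stoup variable z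
plug : ∀ {Γ Δ C A} → Tm Γ (just C) A → Tm Γ Δ (U C) → Tm Γ Δ A
plug svar t = t
plug cunit t = cunit
plug (cpair u v) t = cpair (plug u t) (plug v t)
plug (cfst u) t = cfst (plug u t)
plug (csnd u) t = csnd (plug u t)
plug (clam u) t = clam (plug u (wk t))
plug (capp u v) t = capp (plug u t) v
plug (letTop u v) t = letTop (plug u t) v
plug (letBang u v) t = letBang (plug u t) v
plug (tensor v u) t = tensor v (plug u t)
plug (letTensor u v) t = letTensor (plug u t) v
plug (abort C u) t = abort C (plug u t)
plug (inl u) t = inl (plug u t)
plug (inr u) t = inr (plug u t)
plug (case s u v) t = case (plug s t) u v
plug (happ s u) t = happ s (plug u t)

infix 4 _≈_
data _≈_ {Γ : Ctx} : ∀ {Δ A} → Tm Γ Δ A → Tm Γ Δ A → Set where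
  ≈refl  : ∀ {Δ A} {t : Tm Γ Δ A} → t ≈ t
  ≈sym   : ∀ {Δ A} {t u : Tm Γ Δ A} → t ≈ u → u ≈ t
  ≈trans : ∀ {Δ A} {t u v : Tm Γ Δ A} → t ≈ u → u ≈ v → t ≈ v
  c-pair : ∀ {A B} {t t' : Tm Γ nothing A} {u u' : Tm Γ nothing B}
         → t ≈ t' → u ≈ u' → pair t u ≈ pair t' u'
  c-fst  : ∀ {A B} {t t' : Tm Γ nothing (A v× B)} → t ≈ t' → fst t ≈ fst t'
  c-snd  : ∀ {A B} {t t' : Tm Γ nothing (A v× B)} → t ≈ t' → snd t ≈ snd t'
  c-lam  : ∀ {A B} {t t' : Tm (A ∷ Γ) nothing B} → t ≈ t' → lam t ≈ lam t'
  c-app  : ∀ {A B} {t t' : Tm Γ nothing (A v→ B)} {u u' : Tm Γ nothing A}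
         → t ≈ t' → u ≈ u' → app t u ≈ app t' u'
  c-cpair : ∀ {Δ C D} {t t' : Tm Γ Δ (U C)} {u u' : Tm Γ Δ (U D)}
          → t ≈ t' → u ≈ u' → cpair t u ≈ cpair t' u'
  c-cfst : ∀ {Δ C D} {t t' : Tm Γ Δ (U (C & D))} → t ≈ t' → cfst t ≈ cfst t'
  c-csnd : ∀ {Δ C D} {t t' : Tm Γ Δ (U (C & D))} → t ≈ t' → csnd t ≈ csnd t'
  c-clam : ∀ {Δ A D} {t t' : Tm (A ∷ Γ) Δ (U D)} → t ≈ t' → clam t ≈ clam t'
  c-capp : ∀ {Δ A D} {t t' : Tm Γ Δ (U (A ⇒ D))} {u u' : Tm Γ nothing A}
         → t ≈ t' → u ≈ u' → capp t u ≈ capp t' u'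
  c-letTop : ∀ {Δ C} {t t' : Tm Γ Δ (U cI)} {u u' : Tm Γ nothing (U C)}
           → t ≈ t' → u ≈ u' → letTop t u ≈ letTop t' u'
  c-bang : ∀ {A} {t t' : Tm Γ nothing A} → t ≈ t' → bang t ≈ bang t'
  c-letBang : ∀ {Δ A D} {t t' : Tm Γ Δ (U (! A))} {u u' : Tm (A ∷ Γ) nothing (U D)}
            → t ≈ t' → u ≈ u' → letBang t u ≈ letBang t' u'
  c-tensor : ∀ {Δ A D} {t t' : Tm Γ nothing A} {u u' : Tm Γ Δ (U D)}
           → t ≈ t' → u ≈ u' → tensor t u ≈ tensor t' u'
  c-letTensor : ∀ {Δ A D C} {s s' : Tm Γ Δ (U (! A ⊗ D))}
                {t t' : Tm (A ∷ Γ) (just D) (U C)}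
              → s ≈ s' → t ≈ t' → letTensor s t ≈ letTensor s' t'
  c-abort : ∀ {Δ C} {t t' : Tm Γ Δ (U c0)} → t ≈ t' → abort C t ≈ abort C t'
  c-inl : ∀ {Δ C D} {t t' : Tm Γ Δ (U C)} → t ≈ t' → inl {D = D} t ≈ inl t'
  c-inr : ∀ {Δ C D} {t t' : Tm Γ Δ (U D)} → t ≈ t' → inr {C = C} t ≈ inr t'
  c-case : ∀ {Δ C D E} {s s' : Tm Γ Δ (U (C ⊕ D))}
           {t t' : Tm Γ (just C) (U E)} {u u' : Tm Γ (just D) (U E)}
         → s ≈ s' → t ≈ t' → u ≈ u' → case s t u ≈ case s' t' u'
  c-hlam : ∀ {C D} {t t' : Tm Γ (just C) (U D)} → t ≈ t' → hlam t ≈ hlam t'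
  c-happ : ∀ {Δ C D} {s s' : Tm Γ nothing (C ⊸ D)} {t t' : Tm Γ Δ (U C)}
         → s ≈ s' → t ≈ t' → happ s t ≈ happ s' t'
  ax-1η : (t : Tm Γ nothing v1) → t ≈ unit
  ax-×β₁ : ∀ {A B} (t : Tm Γ nothing A) (u : Tm Γ nothing B) → fst (pair t u) ≈ t
  ax-×β₂ : ∀ {A B} (t : Tm Γ nothing A) (u : Tm Γ nothing B) → snd (pair t u) ≈ u
  ax-×η : ∀ {A B} (t : Tm Γ nothing (A v× B)) → pair (fst t) (snd t) ≈ t
  ax-→β : ∀ {A B} (t : Tm (A ∷ Γ) nothing B) (u : Tm Γ nothing A) → app (lam t) u ≈ t [ u ]
  ax-→η : ∀ {A B} (t : Tm Γ nothing (A v→ B)) → lam (app (wk t) (var Z)) ≈ t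
  ax-1̲η : ∀ {Δ} (t : Tm Γ Δ (U c1)) → t ≈ cunit
  ax-&β₁ : ∀ {Δ C D} (t : Tm Γ Δ (U C)) (u : Tm Γ Δ (U D)) → cfst (cpair t u) ≈ t
  ax-&β₂ : ∀ {Δ C D} (t : Tm Γ Δ (U C)) (u : Tm Γ Δ (U D)) → csnd (cpair t u) ≈ u
  ax-&η : ∀ {Δ C D} (t : Tm Γ Δ (U (C & D))) → cpair (cfst t) (csnd t) ≈ t
  ax-⇒β : ∀ {Δ A D} (t : Tm (A ∷ Γ) Δ (U D)) (u : Tm Γ nothing A) → capp (clam t) u ≈ t [ u ]
  ax-⇒η : ∀ {Δ A D} (t : Tm Γ Δ (U (A ⇒ D))) → clam (capp (wk t) (var Z)) ≈ t
  ax-Iβ : ∀ {C} (t : Tm Γ nothing (U C)) → letTop top t ≈ t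
  ax-Iη : ∀ {Δ C} (t : Tm Γ Δ (U cI)) (u : Tm Γ (just cI) (U C))
        → letTop t (plug u top) ≈ plug u t
  ax-!β : ∀ {A D} (t : Tm Γ nothing A) (u : Tm (A ∷ Γ) nothing (U D))
        → letBang (bang t) u ≈ u [ t ]
  ax-!η : ∀ {Δ A D} (t : Tm Γ Δ (U (! A))) (u : Tm Γ (just (! A)) (U D))
        → letBang t (plug (wk u) (bang (var Z))) ≈ plug u t
  ax-⊗β : ∀ {Δ A D C} (t : Tm Γ nothing A) (s : Tm Γ Δ (U D)) (u : Tm (A ∷ Γ) (just D) (U C))
        → letTensor (tensor t s) u ≈ plug (u [ t ]) s
  ax-⊗η : ∀ {Δ A D C} (t : Tm Γ Δ (U (! A ⊗ D))) (u : Tm Γ (just (! A ⊗ D)) (U C))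
        → letTensor t (plug (wk u) (tensor (var Z) svar)) ≈ plug u t
  ax-0η : ∀ {Δ C} (t : Tm Γ Δ (U c0)) (u : Tm Γ (just c0) (U C)) → abort C t ≈ plug u t
  ax-⊕β₁ : ∀ {Δ C D E} (t : Tm Γ Δ (U C)) (u : Tm Γ (just C) (U E)) (u' : Tm Γ (just D) (U E))
         → case (inl t) u u' ≈ plug u t
  ax-⊕β₂ : ∀ {Δ C D E} (t : Tm Γ Δ (U D)) (u : Tm Γ (just C) (U E)) (u' : Tm Γ (just D) (U E))
         → case (inr t) u u' ≈ plug u' t
  ax-⊕η : ∀ {Δ C D E} (t : Tm Γ Δ (U (C ⊕ D))) (u : Tm Γ (just (C ⊕ D)) (U E))
        → case t (plug u (inl svar)) (plug u (inr svar)) ≈ plug u t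
  ax-⊸β : ∀ {Δ C D} (t : Tm Γ (just C) (U D)) (u : Tm Γ Δ (U C)) → happ (hlam t) u ≈ plug t u
  ax-⊸η : ∀ {C D} (t : Tm Γ nothing (C ⊸ D)) → hlam (happ t svar) ≈ t

data STy : Set where
  sα   : ℕ → STy
  s1   : STy
  _s×_ : STy → STy → STy
  _s→_ : STy → STy → STy

SCtx : Set
SCtx = List STy

data STm (Θ : SCtx) : STy → Set where
  `var  : ∀ {σ} → Θ ∋ σ → STm Θ σ
  `unit : STm Θ s1
  `pair : ∀ {σ τ} → STm Θ σ → STm Θ τ → STm Θ (σ s× τ)
  `fst  : ∀ {σ τ} → STm Θ (σ s× τ) → STm Θ σ
  `snd  : ∀ {σ τ} → STm Θ (σ s× τ) → STm Θ τ
  `lam  : ∀ {σ τ} → STm (σ ∷ Θ) τ → STm Θ (σ s→ τ)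
  `app  : ∀ {σ τ} → STm Θ (σ s→ τ) → STm Θ σ → STm Θ τ

SRen : SCtx → SCtx → Set
SRen Θ Θ' = ∀ {σ} → Θ ∋ σ → Θ' ∋ σ

sextR : ∀ {Θ Θ' ρ} → SRen Θ Θ' → SRen (ρ ∷ Θ) (ρ ∷ Θ')
sextR r Z     = Z
sextR r (S x) = S (r x)

srename : ∀ {Θ Θ' σ} → SRen Θ Θ' → STm Θ σ → STm Θ' σ
srename r (`var x) = `var (r x)
srename r `unit = `unit
srename r (`pair M N) = `pair (srename r M) (srename r N)
srename r (`fst M) = `fst (srename r M)
srename r (`snd M) = `snd (srename r M)
srename r (`lam M) = `lam (srename (sextR r) M)
srename r (`app M N) = `app (srename r M) (srename r N)

swk : ∀ {Θ σ ρ} → STm Θ σ → STm (ρ ∷ Θ) σ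
swk = srename S_

SSub : SCtx → SCtx → Set
SSub Θ Θ' = ∀ {σ} → Θ ∋ σ → STm Θ' σ

sextS : ∀ {Θ Θ' ρ} → SSub Θ Θ' → SSub (ρ ∷ Θ) (ρ ∷ Θ')
sextS s Z     = `var Z
sextS s (S x) = swk (s x)

ssubst : ∀ {Θ Θ' σ} → SSub Θ Θ' → STm Θ σ → STm Θ' σ
ssubst s (`var x) = s x
ssubst s `unit = `unit
ssubst s (`pair M N) = `pair (ssubst s M) (ssubst s N)
ssubst s (`fst M) = `fst (ssubst s M)
ssubst s (`snd M) = `snd (ssubst s M)
ssubst s (`lam M) = `lam (ssubst (sextS s) M)
ssubst s (`app M N) = `app (ssubst s M) (ssubst s N)

ssub0 : ∀ {Θ σ} → STm Θ σ → SSub (σ ∷ Θ) Θ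
ssub0 N Z     = N
ssub0 N (S x) = `var x

_s[_] : ∀ {Θ σ τ} → STm (σ ∷ Θ) τ → STm Θ σ → STm Θ τ
M s[ N ] = ssubst (ssub0 N) M

`let : ∀ {Θ σ τ} → STm Θ σ → STm (σ ∷ Θ) τ → STm Θ τ
`let M N = `app (`lam N) M

-- values of λc (Moggi's existence predicate)
data Value {Θ : SCtx} : ∀ {σ} → STm Θ σ → Set where
  v-var  : ∀ {σ} (x : Θ ∋ σ) → Value (`var x)
  v-unit : Value `unit
  v-pair : ∀ {σ τ} {V : STm Θ σ} {W : STm Θ τ} → Value V → Value W → Value (`pair V W)
  v-fst  : ∀ {σ τ} {V : STm Θ (σ s× τ)} → Value V → Value (`fst V)
  v-snd  : ∀ {σ τ} {V : STm Θ (σ s× τ)} → Value V → Value (`snd V)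
  v-lam  : ∀ {σ τ} (M : STm (σ ∷ Θ) τ) → Value (`lam M)

infix 4 _=λc_
data _=λc_ {Θ : SCtx} : ∀ {σ} → STm Θ σ → STm Θ σ → Set where
  λc-refl  : ∀ {σ} {M : STm Θ σ} → M =λc M
  λc-sym   : ∀ {σ} {M N : STm Θ σ} → M =λc N → N =λc M
  λc-trans : ∀ {σ} {M N P : STm Θ σ} → M =λc N → N =λc P → M =λc P
  λc-pair : ∀ {σ τ} {M M' : STm Θ σ} {N N' : STm Θ τ}
          → M =λc M' → N =λc N' → `pair M N =λc `pair M' N'
  λc-fst : ∀ {σ τ} {M M' : STm Θ (σ s× τ)} → M =λc M' → `fst M =λc `fst M'
  λc-snd : ∀ {σ τ} {M M' : STm Θ (σ s× τ)} → M =λc M' → `snd M =λc `snd M'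
  λc-lam : ∀ {σ τ} {M M' : STm (σ ∷ Θ) τ} → M =λc M' → `lam M =λc `lam M'
  λc-app : ∀ {σ τ} {M M' : STm Θ (σ s→ τ)} {N N' : STm Θ σ}
         → M =λc M' → N =λc N' → `app M N =λc `app M' N'
  λc-βv : ∀ {σ τ} (M : STm (σ ∷ Θ) τ) {V : STm Θ σ} → Value V → `app (`lam M) V =λc M s[ V ]
  λc-ηv : ∀ {σ τ} {V : STm Θ (σ s→ τ)} → Value V → `lam (`app (swk V) (`var Z)) =λc V
  λc-×β₁ : ∀ {σ τ} {V : STm Θ σ} {W : STm Θ τ} → Value V → Value W → `fst (`pair V W) =λc V
  λc-×β₂ : ∀ {σ τ} {V : STm Θ σ} {W : STm Θ τ} → Value V → Value W → `snd (`pair V W) =λc W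
  λc-×η : ∀ {σ τ} {V : STm Θ (σ s× τ)} → Value V → `pair (`fst V) (`snd V) =λc V
  λc-1η : {V : STm Θ s1} → Value V → V =λc `unit
  λc-id : ∀ {σ} (M : STm Θ σ) → `let M (`var Z) =λc M
  λc-comp : ∀ {σ ρ τ} (L : STm Θ σ) (M : STm (σ ∷ Θ) ρ) (N : STm (ρ ∷ Θ) τ)
          → `let (`let L M) N =λc `let L (`let M (srename (sextR S_) N))
  λc-let-pair : ∀ {σ τ} (M : STm Θ σ) (N : STm Θ τ)
              → `pair M N =λc `let M (`let (swk N) (`pair (`var (S Z)) (`var Z)))
  λc-let-fst : ∀ {σ τ} (M : STm Θ (σ s× τ)) → `fst M =λc `let M (`fst (`var Z))
  λc-let-snd : ∀ {σ τ} (M : STm Θ (σ s× τ)) → `snd M =λc `let M (`snd (`var Z))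
  λc-let-app : ∀ {σ τ} (M : STm Θ (σ s→ τ)) (N : STm Θ σ)
             → `app M N =λc `let M (`let (swk N) (`app (`var (S Z)) (`var Z)))

lvTy : CTy → STy → VTy
lvTy R (sα n)  = vα n
lvTy R s1      = v1
lvTy R (σ s× τ) = lvTy R σ v× lvTy R τ
lvTy R (σ s→ τ) = lvTy R σ v→ ((lvTy R τ ⇒ R) ⊸ R)

lvAns : CTy → STy → VTy
lvAns R τ = (lvTy R τ ⇒ R) ⊸ R

lvCtx : CTy → SCtx → Ctx
lvCtx R Θ = map (lvTy R) Θ

lvVar : ∀ {R Θ σ} → Θ ∋ σ → lvCtx R Θ ∋ lvTy R σ
lvVar Z     = Z
lvVar (S x) = S (lvVar x)

lv : ∀ (R : CTy) {Θ τ} → STm Θ τ → Tm (lvCtx R Θ) nothing (lvAns R τ)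
lv R (`var x) = hlam (capp svar (var (lvVar x)))
lv R `unit = hlam (capp svar unit)
lv R (`pair M N) =
  hlam (happ (lv R M) (clam (happ (wk (lv R N)) (clam (capp svar (pair (var (S Z)) (var Z)))))))
lv R (`fst M) = hlam (happ (lv R M) (clam (capp svar (fst (var Z)))))
lv R (`snd M) = hlam (happ (lv R M) (clam (capp svar (snd (var Z)))))
lv R (`lam M) = hlam (capp svar (lam (lv R M)))
lv R (`app M N) =
  hlam (happ (lv R M) (clam (happ (wk (lv R N)) (clam (happ (app (var (S Z)) (var Z)) svar)))))

module Submission where

-- 1. Syntactic metatheory of EEC: fusion laws for renaming and substitution,
--    renaming commutes with plugging the stoup and preserves EEC equality
--    (so equations can be weakened under the binders of the translation).
-- 2. The target is a continuation monad: with  ret a = λ̂k. k@a  and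
--    m >>= n = λ̂k. m{λx. n{k}}  the monad laws hold in EEC, the translation
--    of  let x = M in N  is  lv M >>= lv N, and lv commutes with renaming.
-- 3. Values are pure: lv V ≈ ret ⌊V⌋ for a value translation ⌊V⌋, hence lv
--    commutes with substitution of values.
-- Soundness is an induction on M =λc N: congruences by congruence of EEC
-- equality, βv by the left unit law and the substitution lemma, the let-laws
-- by the monad laws, and the other axioms by computing translations of values.

open import Data.List using (_∷_)
open import Data.Maybe using (nothing; just)
open import Relation.Binary.Bundles using (Setoid)
open import Relation.Binary.PropositionalEquality
  using (_≡_; refl; sym; trans; cong; cong₂)
import Relation.Binary.Reasoning.Setoid as SetoidReasoning

open import Defs

variable
  Γ Γ' Γ₁ Γ₂ Γ₃ : Ctx
  Δ : Stoup
  A B E : VTy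
  C : CTy

cong₃ : ∀ {X Y Z W : Set} (f : X → Y → Z → W) {x x' y y' z z'}
      → x ≡ x' → y ≡ y' → z ≡ z' → f x y z ≡ f x' y' z'
cong₃ f refl refl refl = refl

-- Fusion laws for renaming and substitution.  Each is stated for a
-- pointwise hypothesis on variables, which is stable under binders.

ren-ren-ext : {ρ₁ : Ren Γ₂ Γ₃} {ρ₂ : Ren Γ₁ Γ₂} {ρ₃ : Ren Γ₁ Γ₃}
            → (∀ {B} (x : Γ₁ ∋ B) → ρ₁ (ρ₂ x) ≡ ρ₃ x)
            → ∀ {B} (x : (A ∷ Γ₁) ∋ B) → extR ρ₁ (extR ρ₂ x) ≡ extR ρ₃ x
ren-ren-ext h Z = refl
ren-ren-ext h (S x) = cong S_ (h x)

ren-ren : {ρ₁ : Ren Γ₂ Γ₃} {ρ₂ : Ren Γ₁ Γ₂} {ρ₃ : Ren Γ₁ Γ₃}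
        → (∀ {B} (x : Γ₁ ∋ B) → ρ₁ (ρ₂ x) ≡ ρ₃ x)
        → (t : Tm Γ₁ Δ A) → rename ρ₁ (rename ρ₂ t) ≡ rename ρ₃ t
ren-ren h (var x) = cong var (h x)
ren-ren h unit = refl
ren-ren h (pair t u) = cong₂ pair (ren-ren h t) (ren-ren h u)
ren-ren h (fst t) = cong fst (ren-ren h t)
ren-ren h (snd t) = cong snd (ren-ren h t)
ren-ren h (lam t) = cong lam (ren-ren (ren-ren-ext h) t)
ren-ren h (app t u) = cong₂ app (ren-ren h t) (ren-ren h u)
ren-ren h svar = refl
ren-ren h cunit = refl
ren-ren h (cpair t u) = cong₂ cpair (ren-ren h t) (ren-ren h u)
ren-ren h (cfst t) = cong cfst (ren-ren h t)
ren-ren h (csnd t) = cong csnd (ren-ren h t)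
ren-ren h (clam t) = cong clam (ren-ren (ren-ren-ext h) t)
ren-ren h (capp t u) = cong₂ capp (ren-ren h t) (ren-ren h u)
ren-ren h top = refl
ren-ren h (letTop t u) = cong₂ letTop (ren-ren h t) (ren-ren h u)
ren-ren h (bang t) = cong bang (ren-ren h t)
ren-ren h (letBang t u) = cong₂ letBang (ren-ren h t) (ren-ren (ren-ren-ext h) u)
ren-ren h (tensor t u) = cong₂ tensor (ren-ren h t) (ren-ren h u)
ren-ren h (letTensor t u) = cong₂ letTensor (ren-ren h t) (ren-ren (ren-ren-ext h) u)
ren-ren h (abort C t) = cong (abort C) (ren-ren h t)
ren-ren h (inl t) = cong inl (ren-ren h t)
ren-ren h (inr t) = cong inr (ren-ren h t)
ren-ren h (case s t u) = cong₃ case (ren-ren h s) (ren-ren h t) (ren-ren h u)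
ren-ren h (hlam t) = cong hlam (ren-ren h t)
ren-ren h (happ t u) = cong₂ happ (ren-ren h t) (ren-ren h u)

wk-ren : {ρ : Ren Γ Γ'} (t : Tm Γ Δ A)
       → rename (extR {B = B} ρ) (wk t) ≡ wk (rename ρ t)
wk-ren t = trans (ren-ren (λ _ → refl) t) (sym (ren-ren (λ _ → refl) t))

sub-ren-ext : {σ : Sub Γ₂ Γ₃} {ρ : Ren Γ₁ Γ₂} {σ' : Sub Γ₁ Γ₃}
            → (∀ {B} (x : Γ₁ ∋ B) → σ (ρ x) ≡ σ' x)
            → ∀ {B} (x : (A ∷ Γ₁) ∋ B) → extS σ (extR ρ x) ≡ extS σ' x
sub-ren-ext h Z = refl
sub-ren-ext h (S x) = cong wk (h x)

sub-ren : {σ : Sub Γ₂ Γ₃} {ρ : Ren Γ₁ Γ₂} {σ' : Sub Γ₁ Γ₃}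
        → (∀ {B} (x : Γ₁ ∋ B) → σ (ρ x) ≡ σ' x)
        → (t : Tm Γ₁ Δ A) → subst σ (rename ρ t) ≡ subst σ' t
sub-ren h (var x) = h x
sub-ren h unit = refl
sub-ren h (pair t u) = cong₂ pair (sub-ren h t) (sub-ren h u)
sub-ren h (fst t) = cong fst (sub-ren h t)
sub-ren h (snd t) = cong snd (sub-ren h t)
sub-ren h (lam t) = cong lam (sub-ren (sub-ren-ext h) t)
sub-ren h (app t u) = cong₂ app (sub-ren h t) (sub-ren h u)
sub-ren h svar = refl
sub-ren h cunit = refl
sub-ren h (cpair t u) = cong₂ cpair (sub-ren h t) (sub-ren h u)
sub-ren h (cfst t) = cong cfst (sub-ren h t)
sub-ren h (csnd t) = cong csnd (sub-ren h t)
sub-ren h (clam t) = cong clam (sub-ren (sub-ren-ext h) t)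
sub-ren h (capp t u) = cong₂ capp (sub-ren h t) (sub-ren h u)
sub-ren h top = refl
sub-ren h (letTop t u) = cong₂ letTop (sub-ren h t) (sub-ren h u)
sub-ren h (bang t) = cong bang (sub-ren h t)
sub-ren h (letBang t u) = cong₂ letBang (sub-ren h t) (sub-ren (sub-ren-ext h) u)
sub-ren h (tensor t u) = cong₂ tensor (sub-ren h t) (sub-ren h u)
sub-ren h (letTensor t u) = cong₂ letTensor (sub-ren h t) (sub-ren (sub-ren-ext h) u)
sub-ren h (abort C t) = cong (abort C) (sub-ren h t)
sub-ren h (inl t) = cong inl (sub-ren h t)
sub-ren h (inr t) = cong inr (sub-ren h t)
sub-ren h (case s t u) = cong₃ case (sub-ren h s) (sub-ren h t) (sub-ren h u)
sub-ren h (hlam t) = cong hlam (sub-ren h t)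
sub-ren h (happ t u) = cong₂ happ (sub-ren h t) (sub-ren h u)

ren-sub-ext : {ρ : Ren Γ₂ Γ₃} {σ : Sub Γ₁ Γ₂} {σ' : Sub Γ₁ Γ₃}
            → (∀ {B} (x : Γ₁ ∋ B) → rename ρ (σ x) ≡ σ' x)
            → ∀ {B} (x : (A ∷ Γ₁) ∋ B) → rename (extR ρ) (extS σ x) ≡ extS σ' x
ren-sub-ext h Z = refl
ren-sub-ext {σ = σ} h (S x) = trans (wk-ren (σ x)) (cong wk (h x))

ren-sub : {ρ : Ren Γ₂ Γ₃} {σ : Sub Γ₁ Γ₂} {σ' : Sub Γ₁ Γ₃}
        → (∀ {B} (x : Γ₁ ∋ B) → rename ρ (σ x) ≡ σ' x)
        → (t : Tm Γ₁ Δ A) → rename ρ (subst σ t) ≡ subst σ' t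
ren-sub h (var x) = h x
ren-sub h unit = refl
ren-sub h (pair t u) = cong₂ pair (ren-sub h t) (ren-sub h u)
ren-sub h (fst t) = cong fst (ren-sub h t)
ren-sub h (snd t) = cong snd (ren-sub h t)
ren-sub h (lam t) = cong lam (ren-sub (ren-sub-ext h) t)
ren-sub h (app t u) = cong₂ app (ren-sub h t) (ren-sub h u)
ren-sub h svar = refl
ren-sub h cunit = refl
ren-sub h (cpair t u) = cong₂ cpair (ren-sub h t) (ren-sub h u)
ren-sub h (cfst t) = cong cfst (ren-sub h t)
ren-sub h (csnd t) = cong csnd (ren-sub h t)
ren-sub h (clam t) = cong clam (ren-sub (ren-sub-ext h) t)
ren-sub h (capp t u) = cong₂ capp (ren-sub h t) (ren-sub h u)
ren-sub h top = refl
ren-sub h (letTop t u) = cong₂ letTop (ren-sub h t) (ren-sub h u)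
ren-sub h (bang t) = cong bang (ren-sub h t)
ren-sub h (letBang t u) = cong₂ letBang (ren-sub h t) (ren-sub (ren-sub-ext h) u)
ren-sub h (tensor t u) = cong₂ tensor (ren-sub h t) (ren-sub h u)
ren-sub h (letTensor t u) = cong₂ letTensor (ren-sub h t) (ren-sub (ren-sub-ext h) u)
ren-sub h (abort C t) = cong (abort C) (ren-sub h t)
ren-sub h (inl t) = cong inl (ren-sub h t)
ren-sub h (inr t) = cong inr (ren-sub h t)
ren-sub h (case s t u) = cong₃ case (ren-sub h s) (ren-sub h t) (ren-sub h u)
ren-sub h (hlam t) = cong hlam (ren-sub h t)
ren-sub h (happ t u) = cong₂ happ (ren-sub h t) (ren-sub h u)

sub-id-ext : {σ : Sub Γ Γ} → (∀ {B} (x : Γ ∋ B) → σ x ≡ var x)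
           → ∀ {B} (x : (A ∷ Γ) ∋ B) → extS σ x ≡ var x
sub-id-ext h Z = refl
sub-id-ext h (S x) = cong wk (h x)

sub-id : {σ : Sub Γ Γ} → (∀ {B} (x : Γ ∋ B) → σ x ≡ var x)
       → (t : Tm Γ Δ A) → subst σ t ≡ t
sub-id h (var x) = h x
sub-id h unit = refl
sub-id h (pair t u) = cong₂ pair (sub-id h t) (sub-id h u)
sub-id h (fst t) = cong fst (sub-id h t)
sub-id h (snd t) = cong snd (sub-id h t)
sub-id h (lam t) = cong lam (sub-id (sub-id-ext h) t)
sub-id h (app t u) = cong₂ app (sub-id h t) (sub-id h u)
sub-id h svar = refl
sub-id h cunit = refl
sub-id h (cpair t u) = cong₂ cpair (sub-id h t) (sub-id h u)
sub-id h (cfst t) = cong cfst (sub-id h t)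
sub-id h (csnd t) = cong csnd (sub-id h t)
sub-id h (clam t) = cong clam (sub-id (sub-id-ext h) t)
sub-id h (capp t u) = cong₂ capp (sub-id h t) (sub-id h u)
sub-id h top = refl
sub-id h (letTop t u) = cong₂ letTop (sub-id h t) (sub-id h u)
sub-id h (bang t) = cong bang (sub-id h t)
sub-id h (letBang t u) = cong₂ letBang (sub-id h t) (sub-id (sub-id-ext h) u)
sub-id h (tensor t u) = cong₂ tensor (sub-id h t) (sub-id h u)
sub-id h (letTensor t u) = cong₂ letTensor (sub-id h t) (sub-id (sub-id-ext h) u)
sub-id h (abort C t) = cong (abort C) (sub-id h t)
sub-id h (inl t) = cong inl (sub-id h t)
sub-id h (inr t) = cong inr (sub-id h t)
sub-id h (case s t u) = cong₃ case (sub-id h s) (sub-id h t) (sub-id h u)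
sub-id h (hlam t) = cong hlam (sub-id h t)
sub-id h (happ t u) = cong₂ happ (sub-id h t) (sub-id h u)

sub0-wk : (a : Tm Γ nothing B) (t : Tm Γ Δ A) → wk t [ a ] ≡ t
sub0-wk a t = trans (sub-ren (λ _ → refl) t) (sub-id (λ _ → refl) t)

sub-wk : (σ : Sub Γ Γ') (t : Tm Γ Δ A) → subst (extS {B = B} σ) (wk t) ≡ wk (subst σ t)
sub-wk σ t = trans (sub-ren (λ _ → refl) t) (sym (ren-sub (λ _ → refl) t))

ren-sub0 : (ρ : Ren Γ Γ') (t : Tm (B ∷ Γ) Δ A) (u : Tm Γ nothing B)
         → rename ρ (t [ u ]) ≡ rename (extR ρ) t [ rename ρ u ]
ren-sub0 ρ t u = trans (ren-sub (λ _ → refl) t) (sym (sub-ren push t))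
  where
  push : ∀ {C} (x : _ ∋ C) → sub0 (rename ρ u) (extR ρ x) ≡ rename ρ (sub0 u x)
  push Z = refl
  push (S x) = refl

sub0-var : (t : Tm (B ∷ Γ) Δ A) → rename (extR S_) t [ var Z ] ≡ t
sub0-var t = trans (sub-ren back t) (sub-id (λ _ → refl) t)
  where
  back : ∀ {C} (x : _ ∋ C) → sub0 (var Z) (extR S_ x) ≡ var x
  back Z = refl
  back (S x) = refl

ren-plug : (ρ : Ren Γ Γ') (u : Tm Γ (just C) A) (t : Tm Γ Δ (U C))
         → rename ρ (plug u t) ≡ plug (rename ρ u) (rename ρ t)
ren-plug ρ svar t = refl
ren-plug ρ cunit t = refl
ren-plug ρ (cpair u v) t = cong₂ cpair (ren-plug ρ u t) (ren-plug ρ v t)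
ren-plug ρ (cfst u) t = cong cfst (ren-plug ρ u t)
ren-plug ρ (csnd u) t = cong csnd (ren-plug ρ u t)
ren-plug ρ (clam u) t =
  cong clam (trans (ren-plug (extR ρ) u (wk t)) (cong (plug (rename (extR ρ) u)) (wk-ren t)))
ren-plug ρ (capp u v) t = cong (λ z → capp z (rename ρ v)) (ren-plug ρ u t)
ren-plug ρ (letTop u v) t = cong (λ z → letTop z (rename ρ v)) (ren-plug ρ u t)
ren-plug ρ (letBang u v) t = cong (λ z → letBang z (rename (extR ρ) v)) (ren-plug ρ u t)
ren-plug ρ (tensor v u) t = cong (tensor (rename ρ v)) (ren-plug ρ u t)
ren-plug ρ (letTensor u v) t = cong (λ z → letTensor z (rename (extR ρ) v)) (ren-plug ρ u t)
ren-plug ρ (abort C u) t = cong (abort C) (ren-plug ρ u t)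
ren-plug ρ (inl u) t = cong inl (ren-plug ρ u t)
ren-plug ρ (inr u) t = cong inr (ren-plug ρ u t)
ren-plug ρ (case s u v) t = cong (λ z → case z (rename ρ u) (rename ρ v)) (ren-plug ρ s t)
ren-plug ρ (happ s u) t = cong (happ (rename ρ s)) (ren-plug ρ u t)

ren-plug-wk : (ρ : Ren Γ Γ') (u : Tm Γ (just C) A) (t : Tm (B ∷ Γ) Δ (U C))
            → rename (extR ρ) (plug (wk u) t) ≡ plug (wk (rename ρ u)) (rename (extR ρ) t)
ren-plug-wk ρ u t = trans (ren-plug (extR ρ) (wk u) t) (cong (λ z → plug z _) (wk-ren u))

≈-setoid : Ctx → Stoup → VTy → Setoid _ _
≈-setoid Γ Δ A = record
  { Carrier = Tm Γ Δ A
  ; _≈_ = _≈_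
  ; isEquivalence = record { refl = ≈refl ; sym = ≈sym ; trans = ≈trans }
  }

module ≈-Reasoning {Γ : Ctx} {Δ : Stoup} {A : VTy} = SetoidReasoning (≈-setoid Γ Δ A)

≡→≈ : {t u : Tm Γ Δ A} → t ≡ u → t ≈ u
≡→≈ refl = ≈refl

-- Renaming preserves EEC equality; for the axioms whose sides involve
-- substitution or plugging this uses that renaming commutes with both.
rename-≈ : (ρ : Ren Γ Γ') {t u : Tm Γ Δ A} → t ≈ u → rename ρ t ≈ rename ρ u
rename-≈ ρ ≈refl = ≈refl
rename-≈ ρ (≈sym p) = ≈sym (rename-≈ ρ p)
rename-≈ ρ (≈trans p q) = ≈trans (rename-≈ ρ p) (rename-≈ ρ q)
rename-≈ ρ (c-pair p q) = c-pair (rename-≈ ρ p) (rename-≈ ρ q)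
rename-≈ ρ (c-fst p) = c-fst (rename-≈ ρ p)
rename-≈ ρ (c-snd p) = c-snd (rename-≈ ρ p)
rename-≈ ρ (c-lam p) = c-lam (rename-≈ (extR ρ) p)
rename-≈ ρ (c-app p q) = c-app (rename-≈ ρ p) (rename-≈ ρ q)
rename-≈ ρ (c-cpair p q) = c-cpair (rename-≈ ρ p) (rename-≈ ρ q)
rename-≈ ρ (c-cfst p) = c-cfst (rename-≈ ρ p)
rename-≈ ρ (c-csnd p) = c-csnd (rename-≈ ρ p)
rename-≈ ρ (c-clam p) = c-clam (rename-≈ (extR ρ) p)
rename-≈ ρ (c-capp p q) = c-capp (rename-≈ ρ p) (rename-≈ ρ q)
rename-≈ ρ (c-letTop p q) = c-letTop (rename-≈ ρ p) (rename-≈ ρ q)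
rename-≈ ρ (c-bang p) = c-bang (rename-≈ ρ p)
rename-≈ ρ (c-letBang p q) = c-letBang (rename-≈ ρ p) (rename-≈ (extR ρ) q)
rename-≈ ρ (c-tensor p q) = c-tensor (rename-≈ ρ p) (rename-≈ ρ q)
rename-≈ ρ (c-letTensor p q) = c-letTensor (rename-≈ ρ p) (rename-≈ (extR ρ) q)
rename-≈ ρ (c-abort p) = c-abort (rename-≈ ρ p)
rename-≈ ρ (c-inl p) = c-inl (rename-≈ ρ p)
rename-≈ ρ (c-inr p) = c-inr (rename-≈ ρ p)
rename-≈ ρ (c-case p q r) = c-case (rename-≈ ρ p) (rename-≈ ρ q) (rename-≈ ρ r)
rename-≈ ρ (c-hlam p) = c-hlam (rename-≈ ρ p)
rename-≈ ρ (c-happ p q) = c-happ (rename-≈ ρ p) (rename-≈ ρ q)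
rename-≈ ρ (ax-1η t) = ax-1η _
rename-≈ ρ (ax-×β₁ t u) = ax-×β₁ _ _
rename-≈ ρ (ax-×β₂ t u) = ax-×β₂ _ _
rename-≈ ρ (ax-×η t) = ax-×η _
rename-≈ ρ (ax-→β t u) = ≈trans (ax-→β _ _) (≡→≈ (sym (ren-sub0 ρ t u)))
rename-≈ ρ (ax-→η t) = ≈trans (≡→≈ (cong (λ z → lam (app z (var Z))) (wk-ren t))) (ax-→η _)
rename-≈ ρ (ax-1̲η t) = ax-1̲η _
rename-≈ ρ (ax-&β₁ t u) = ax-&β₁ _ _
rename-≈ ρ (ax-&β₂ t u) = ax-&β₂ _ _
rename-≈ ρ (ax-&η t) = ax-&η _
rename-≈ ρ (ax-⇒β t u) = ≈trans (ax-⇒β _ _) (≡→≈ (sym (ren-sub0 ρ t u)))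
rename-≈ ρ (ax-⇒η t) = ≈trans (≡→≈ (cong (λ z → clam (capp z (var Z))) (wk-ren t))) (ax-⇒η _)
rename-≈ ρ (ax-Iβ t) = ax-Iβ _
rename-≈ ρ (ax-Iη t u) =
  ≈trans (≡→≈ (cong (letTop _) (ren-plug ρ u top))) (≈trans (ax-Iη _ _) (≡→≈ (sym (ren-plug ρ u t))))
rename-≈ ρ (ax-!β t u) = ≈trans (ax-!β _ _) (≡→≈ (sym (ren-sub0 ρ u t)))
rename-≈ ρ (ax-!η t u) =
  ≈trans (≡→≈ (cong (letBang _) (ren-plug-wk ρ u _))) (≈trans (ax-!η _ _) (≡→≈ (sym (ren-plug ρ u t))))
rename-≈ ρ (ax-⊗β t s u) =
  ≈trans (ax-⊗β _ _ _)
    (≡→≈ (sym (trans (ren-plug ρ (u [ t ]) s) (cong (λ z → plug z _) (ren-sub0 ρ u t)))))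
rename-≈ ρ (ax-⊗η t u) =
  ≈trans (≡→≈ (cong (letTensor _) (ren-plug-wk ρ u _))) (≈trans (ax-⊗η _ _) (≡→≈ (sym (ren-plug ρ u t))))
rename-≈ ρ (ax-0η t u) = ≈trans (ax-0η _ _) (≡→≈ (sym (ren-plug ρ u t)))
rename-≈ ρ (ax-⊕β₁ t u u') = ≈trans (ax-⊕β₁ _ _ _) (≡→≈ (sym (ren-plug ρ u t)))
rename-≈ ρ (ax-⊕β₂ t u u') = ≈trans (ax-⊕β₂ _ _ _) (≡→≈ (sym (ren-plug ρ u' t)))
rename-≈ ρ (ax-⊕η t u) =
  ≈trans (≡→≈ (cong₂ (case _) (ren-plug ρ u (inl svar)) (ren-plug ρ u (inr svar))))
    (≈trans (ax-⊕η _ _) (≡→≈ (sym (ren-plug ρ u t))))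
rename-≈ ρ (ax-⊸β t u) = ≈trans (ax-⊸β _ _) (≡→≈ (sym (ren-plug ρ t u)))
rename-≈ ρ (ax-⊸η t) = ax-⊸η _

wk-≈ : {t u : Tm Γ Δ A} → t ≈ u → wk {B = B} t ≈ wk u
wk-≈ = rename-≈ S_

variable
  Θ Θ' : SCtx
  σ τ υ : STy

module CPS (R : CTy) where

  -- The continuation monad T A = (A ⇒ R) ⊸ R, into which lv translates:
  -- lvAns R τ is T (lvTy R τ).

  T : VTy → VTy
  T A = (A ⇒ R) ⊸ R

  ret : Tm Γ nothing A → Tm Γ nothing (T A)
  ret a = hlam (capp svar a)

  infixl 5 _>>=_
  _>>=_ : Tm Γ nothing (T A) → Tm (A ∷ Γ) nothing (T B) → Tm Γ nothing (T B)
  m >>= n = hlam (happ m (clam (happ n svar)))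

  >>=-cong : {m m' : Tm Γ nothing (T A)} {n n' : Tm (A ∷ Γ) nothing (T B)}
           → m ≈ m' → n ≈ n' → m >>= n ≈ m' >>= n'
  >>=-cong p q = c-hlam (c-happ p (c-clam (c-happ q ≈refl)))

  ret-cong : {a b : Tm Γ nothing A} → a ≈ b → ret a ≈ ret b
  ret-cong p = c-hlam (c-capp ≈refl p)

  ret-β : (a : Tm Γ nothing A) (b : Tm (A ∷ Γ) Δ (U R)) → happ (ret a) (clam b) ≈ b [ a ]
  ret-β a b = ≈trans (ax-⊸β _ _) (ax-⇒β _ _)

  happ-ret : {n : Tm Γ nothing (T A)} {b : Tm Γ nothing A} → n ≈ ret b → happ n svar ≈ capp svar b
  happ-ret q = ≈trans (c-happ q ≈refl) (ax-⊸β _ _)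

  >>=-ret : {m : Tm Γ nothing (T A)} {n : Tm (A ∷ Γ) nothing (T B)} {b : Tm (A ∷ Γ) nothing B}
          → n ≈ ret b → m >>= n ≈ hlam (happ m (clam (capp svar b)))
  >>=-ret q = c-hlam (c-happ ≈refl (c-clam (happ-ret q)))

  >>=-unitˡ : (a : Tm Γ nothing A) (n : Tm (A ∷ Γ) nothing (T B)) → ret a >>= n ≈ n [ a ]
  >>=-unitˡ a n = ≈trans (c-hlam (ret-β a (happ n svar))) (ax-⊸η _)

  >>=-unitʳ : (m : Tm Γ nothing (T A)) → m >>= ret (var Z) ≈ m
  >>=-unitʳ m = ≈trans (>>=-ret ≈refl) (≈trans (c-hlam (c-happ ≈refl (ax-⇒η svar))) (ax-⊸η m))

  >>=-nested : (l : Tm Γ nothing (T A)) (m : Tm (A ∷ Γ) nothing (T B))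
               (n : Tm (B ∷ A ∷ Γ) nothing (T E))
             → l >>= (m >>= n) ≈ hlam (happ l (clam (happ m (clam (happ n svar)))))
  >>=-nested l m n = c-hlam (c-happ ≈refl (c-clam (ax-⊸β _ _)))

  >>=-assoc : (l : Tm Γ nothing (T A)) (m : Tm (A ∷ Γ) nothing (T B))
              (n : Tm (B ∷ Γ) nothing (T E))
            → (l >>= m) >>= n ≈ l >>= (m >>= rename (extR S_) n)
  >>=-assoc l m n = ≈trans (c-hlam (ax-⊸β _ _)) (≈sym (>>=-nested l m (rename (extR S_) n)))

  lv-let : (M : STm Θ σ) (N : STm (σ ∷ Θ) τ) → lv R (`let M N) ≈ lv R M >>= lv R N
  lv-let M N =
    begin
      lv R (`let M N)
    ≡⟨⟩
      hlam (happ (ret f) (clam (happ (wk (lv R M)) (clam (happ (app (var (S Z)) (var Z)) svar)))))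
    ≈⟨ c-hlam (ret-β _ _) ⟩
      hlam (happ (wk (lv R M) [ f ]) (clam (happ (app (wk f) (var Z)) svar)))
    ≡⟨ cong (λ m → hlam (happ m (clam (happ (app (wk f) (var Z)) svar)))) (sub0-wk f (lv R M)) ⟩
      lv R M >>= app (wk f) (var Z)
    ≈⟨ >>=-cong ≈refl (≈trans (ax-→β _ _) (≡→≈ (sub0-var (lv R N)))) ⟩
      lv R M >>= lv R N
    ∎
    where
    open ≈-Reasoning
    f = lam (lv R N)

  Tracks : SRen Θ Θ' → Ren (lvCtx R Θ) (lvCtx R Θ') → Set
  Tracks {Θ} r ρ = ∀ {σ} (x : Θ ∋ σ) → ρ (lvVar x) ≡ lvVar (r x)

  tracks-ext : {r : SRen Θ Θ'} {ρ : Ren (lvCtx R Θ) (lvCtx R Θ')}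
             → Tracks r ρ → Tracks (sextR {ρ = σ} r) (extR ρ)
  tracks-ext h Z = refl
  tracks-ext h (S x) = cong S_ (h x)

  lv-rename : {r : SRen Θ Θ'} {ρ : Ren (lvCtx R Θ) (lvCtx R Θ')}
            → Tracks r ρ → (M : STm Θ τ) → lv R (srename r M) ≡ rename ρ (lv R M)
  lv-rename h (`var x) = cong (λ y → ret (var y)) (sym (h x))
  lv-rename h `unit = refl
  lv-rename h (`pair M N) =
    cong₂ (λ m n → hlam (happ m (clam (happ n (clam (capp svar (pair (var (S Z)) (var Z))))))))
      (lv-rename h M) (trans (cong wk (lv-rename h N)) (sym (wk-ren (lv R N))))
  lv-rename h (`fst M) = cong (λ m → hlam (happ m (clam (capp svar (fst (var Z)))))) (lv-rename h M)
  lv-rename h (`snd M) = cong (λ m → hlam (happ m (clam (capp svar (snd (var Z)))))) (lv-rename h M)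
  lv-rename h (`lam M) = cong (λ m → ret (lam m)) (lv-rename (tracks-ext h) M)
  lv-rename h (`app M N) =
    cong₂ (λ m n → hlam (happ m (clam (happ n (clam (happ (app (var (S Z)) (var Z)) svar))))))
      (lv-rename h M) (trans (cong wk (lv-rename h N)) (sym (wk-ren (lv R N))))

  lv-wk : (M : STm Θ τ) → lv R (swk {ρ = σ} M) ≡ wk (lv R M)
  lv-wk = lv-rename (λ _ → refl)

  lv-pair-ret : (M : STm Θ σ) (N : STm Θ τ) {a : Tm (lvCtx R Θ) nothing (lvTy R σ)}
                {b : Tm (lvCtx R Θ) nothing (lvTy R τ)}
              → lv R M ≈ ret a → lv R N ≈ ret b → lv R (`pair M N) ≈ ret (pair a b)
  lv-pair-ret M N {a} {b} p q =
    begin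
      lv R (`pair M N)
    ≈⟨ c-hlam (c-happ p (c-clam (c-happ (wk-≈ q) ≈refl))) ⟩
      hlam (happ (ret a) (clam (happ (ret (wk b)) (clam (capp svar (pair (var (S Z)) (var Z)))))))
    ≈⟨ c-hlam (ret-β _ _) ⟩
      hlam (happ (ret (wk b [ a ])) (clam (capp svar (pair (wk a) (var Z)))))
    ≡⟨ cong (λ z → hlam (happ (ret z) (clam (capp svar (pair (wk a) (var Z)))))) (sub0-wk a b) ⟩
      hlam (happ (ret b) (clam (capp svar (pair (wk a) (var Z)))))
    ≈⟨ c-hlam (ret-β _ _) ⟩
      ret (pair (wk a [ b ]) b)
    ≡⟨ cong (λ z → ret (pair z b)) (sub0-wk b a) ⟩
      ret (pair a b)
    ∎
    where open ≈-Reasoning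

  lv-fst-ret : (M : STm Θ (σ s× τ)) {a : Tm (lvCtx R Θ) nothing (lvTy R (σ s× τ))}
             → lv R M ≈ ret a → lv R (`fst M) ≈ ret (fst a)
  lv-fst-ret _ p = ≈trans (c-hlam (c-happ p ≈refl)) (c-hlam (ret-β _ _))

  lv-snd-ret : (M : STm Θ (σ s× τ)) {a : Tm (lvCtx R Θ) nothing (lvTy R (σ s× τ))}
             → lv R M ≈ ret a → lv R (`snd M) ≈ ret (snd a)
  lv-snd-ret _ p = ≈trans (c-hlam (c-happ p ≈refl)) (c-hlam (ret-β _ _))

  lv-app-ret : (M : STm Θ (σ s→ τ)) (N : STm Θ σ) {f : Tm (lvCtx R Θ) nothing (lvTy R (σ s→ τ))}
               {a : Tm (lvCtx R Θ) nothing (lvTy R σ)}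
             → lv R M ≈ ret f → lv R N ≈ ret a → lv R (`app M N) ≈ app f a
  lv-app-ret M N {f} {a} p q =
    begin
      lv R (`app M N)
    ≈⟨ c-hlam (c-happ p (c-clam (c-happ (wk-≈ q) ≈refl))) ⟩
      hlam (happ (ret f) (clam (happ (ret (wk a)) (clam (happ (app (var (S Z)) (var Z)) svar)))))
    ≈⟨ c-hlam (ret-β _ _) ⟩
      hlam (happ (ret (wk a [ f ])) (clam (happ (app (wk f) (var Z)) svar)))
    ≡⟨ cong (λ z → hlam (happ (ret z) (clam (happ (app (wk f) (var Z)) svar)))) (sub0-wk f a) ⟩
      hlam (happ (ret a) (clam (happ (app (wk f) (var Z)) svar)))
    ≈⟨ c-hlam (ret-β _ _) ⟩
      hlam (happ (app (wk f [ a ]) a) svar)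
    ≡⟨ cong (λ z → hlam (happ (app z a) svar)) (sub0-wk a f) ⟩
      hlam (happ (app f a) svar)
    ≈⟨ ax-⊸η _ ⟩
      app f a
    ∎
    where open ≈-Reasoning

  ⌊_⌋ : {V : STm Θ σ} → Value V → Tm (lvCtx R Θ) nothing (lvTy R σ)
  ⌊ v-var x ⌋ = var (lvVar x)
  ⌊ v-unit ⌋ = unit
  ⌊ v-pair v w ⌋ = pair ⌊ v ⌋ ⌊ w ⌋
  ⌊ v-fst v ⌋ = fst ⌊ v ⌋
  ⌊ v-snd v ⌋ = snd ⌊ v ⌋
  ⌊ v-lam M ⌋ = lam (lv R M)

  lv-value : {V : STm Θ σ} (v : Value V) → lv R V ≈ ret ⌊ v ⌋
  lv-value (v-var x) = ≈refl
  lv-value v-unit = ≈refl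
  lv-value (v-pair {V = V} {W} v w) = lv-pair-ret V W (lv-value v) (lv-value w)
  lv-value (v-fst {V = V} v) = lv-fst-ret V (lv-value v)
  lv-value (v-snd {V = V} v) = lv-snd-ret V (lv-value v)
  lv-value (v-lam M) = ≈refl

  -- An EEC substitution γ translates a source substitution s if each
  -- s x translates to a term returning γ applied to the translation of x;
  -- by lv-value this holds for substitutions of values.
  Translates : SSub Θ Θ' → Sub (lvCtx R Θ) (lvCtx R Θ') → Set
  Translates {Θ} s γ = ∀ {σ} (x : Θ ∋ σ) → lv R (s x) ≈ ret (γ (lvVar x))

  translates-ext : {s : SSub Θ Θ'} {γ : Sub (lvCtx R Θ) (lvCtx R Θ')}
                 → Translates s γ → Translates (sextS {ρ = σ} s) (extS γ)
  translates-ext h Z = ≈refl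
  translates-ext {s = s} h (S x) = ≈trans (≡→≈ (lv-wk (s x))) (wk-≈ (h x))

  lv-subst : {s : SSub Θ Θ'} {γ : Sub (lvCtx R Θ) (lvCtx R Θ')}
           → Translates s γ → (M : STm Θ τ) → lv R (ssubst s M) ≈ subst γ (lv R M)

  lv-subst-wk : {s : SSub Θ Θ'} {γ : Sub (lvCtx R Θ) (lvCtx R Θ')}
              → Translates s γ → (N : STm Θ τ)
              → wk {B = A} (lv R (ssubst s N)) ≈ subst (extS γ) (wk (lv R N))

  lv-subst h (`var x) = h x
  lv-subst h `unit = ≈refl
  lv-subst h (`pair M N) = c-hlam (c-happ (lv-subst h M) (c-clam (c-happ (lv-subst-wk h N) ≈refl)))
  lv-subst h (`fst M) = c-hlam (c-happ (lv-subst h M) ≈refl)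
  lv-subst h (`snd M) = c-hlam (c-happ (lv-subst h M) ≈refl)
  lv-subst h (`lam M) = ret-cong (c-lam (lv-subst (translates-ext h) M))
  lv-subst h (`app M N) = c-hlam (c-happ (lv-subst h M) (c-clam (c-happ (lv-subst-wk h N) ≈refl)))

  lv-subst-wk {γ = γ} h N = ≈trans (wk-≈ (lv-subst h N)) (≡→≈ (sym (sub-wk γ (lv R N))))

  lv-subst-value : (M : STm (σ ∷ Θ) τ) {V : STm Θ σ} (v : Value V)
                 → lv R (M s[ V ]) ≈ lv R M [ ⌊ v ⌋ ]
  lv-subst-value M v = lv-subst value-translates M
    where
    value-translates : Translates (ssub0 _) (sub0 ⌊ v ⌋)
    value-translates Z = lv-value v
    value-translates (S x) = ≈refl

  lv-let₂ : (M : STm Θ σ) (N : STm Θ τ) (K : STm (τ ∷ σ ∷ Θ) υ)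
          → lv R (`let M (`let (swk N) K))
            ≈ hlam (happ (lv R M) (clam (happ (wk (lv R N)) (clam (happ (lv R K) svar)))))
  lv-let₂ M N K =
    ≈trans (lv-let M (`let (swk N) K))
      (≈trans (>>=-cong ≈refl (≈trans (lv-let (swk N) K) (>>=-cong (≡→≈ (lv-wk N)) ≈refl)))
        (>>=-nested (lv R M) (wk (lv R N)) (lv R K)))

  βv-sound : (M : STm (σ ∷ Θ) τ) {V : STm Θ σ} (v : Value V)
           → lv R (`app (`lam M) V) ≈ lv R (M s[ V ])
  βv-sound M {V} v =
    begin
      lv R (`let V M)            ≈⟨ lv-let V M ⟩
      lv R V >>= lv R M          ≈⟨ >>=-cong (lv-value v) ≈refl ⟩
      ret ⌊ v ⌋ >>= lv R M       ≈⟨ >>=-unitˡ ⌊ v ⌋ (lv R M) ⟩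
      lv R M [ ⌊ v ⌋ ]           ≈⟨ lv-subst-value M v ⟨
      lv R (M s[ V ])            ∎
    where open ≈-Reasoning

  ηv-sound : {V : STm Θ (σ s→ τ)} (v : Value V) → lv R (`lam (`app (swk V) (`var Z))) ≈ lv R V
  ηv-sound {V = V} v =
    begin
      ret (lam (lv R (`app (swk V) (`var Z))))
        ≈⟨ ret-cong (c-lam (lv-app-ret (swk V) (`var Z) lv-swk-V ≈refl)) ⟩
      ret (lam (app (wk ⌊ v ⌋) (var Z)))   ≈⟨ ret-cong (ax-→η _) ⟩
      ret ⌊ v ⌋                            ≈⟨ lv-value v ⟨
      lv R V                               ∎
    where
    open ≈-Reasoning
    lv-swk-V : lv R (swk V) ≈ ret (wk ⌊ v ⌋)
    lv-swk-V = ≈trans (≡→≈ (lv-wk V)) (wk-≈ (lv-value v))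

  comp-sound : (L : STm Θ σ) (M : STm (σ ∷ Θ) τ) (N : STm (τ ∷ Θ) υ)
             → lv R (`let (`let L M) N) ≈ lv R (`let L (`let M (srename (sextR S_) N)))
  comp-sound L M N =
    begin
      lv R (`let (`let L M) N)                 ≈⟨ lv-let (`let L M) N ⟩
      lv R (`let L M) >>= lv R N               ≈⟨ >>=-cong (lv-let L M) ≈refl ⟩
      (lv R L >>= lv R M) >>= lv R N           ≈⟨ >>=-assoc (lv R L) (lv R M) (lv R N) ⟩
      lv R L >>= (lv R M >>= rename (extR S_) (lv R N))
        ≡⟨ cong (λ n → lv R L >>= (lv R M >>= n)) (lv-rename (tracks-ext (λ _ → refl)) N) ⟨
      lv R L >>= (lv R M >>= lv R N')          ≈⟨ >>=-cong ≈refl (lv-let M N') ⟨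
      lv R L >>= lv R (`let M N')              ≈⟨ lv-let L (`let M N') ⟨
      lv R (`let L (`let M N'))                ∎
    where
    open ≈-Reasoning
    N' = srename (sextR S_) N

  x₀ : STm (σ ∷ Θ) σ
  x₀ = `var Z

  x₁ : STm (τ ∷ σ ∷ Θ) σ
  x₁ = `var (S Z)

  let-pair-sound : (M : STm Θ σ) (N : STm Θ τ)
                 → lv R (`let M (`let (swk N) (`pair x₁ x₀))) ≈ lv R (`pair M N)
  let-pair-sound M N =
    ≈trans (lv-let₂ M N (`pair x₁ x₀))
      (c-hlam (c-happ ≈refl (c-clam (c-happ ≈refl
        (c-clam (happ-ret (lv-pair-ret x₁ x₀ ≈refl ≈refl)))))))

  let-app-sound : (M : STm Θ (σ s→ τ)) (N : STm Θ σ)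
                → lv R (`let M (`let (swk N) (`app x₁ x₀))) ≈ lv R (`app M N)
  let-app-sound M N =
    ≈trans (lv-let₂ M N (`app x₁ x₀))
      (c-hlam (c-happ ≈refl (c-clam (c-happ ≈refl
        (c-clam (c-happ (lv-app-ret x₁ x₀ ≈refl ≈refl) ≈refl))))))

  sound : {M N : STm Θ τ} → M =λc N → lv R M ≈ lv R N
  sound λc-refl = ≈refl
  sound (λc-sym p) = ≈sym (sound p)
  sound (λc-trans p q) = ≈trans (sound p) (sound q)
  sound (λc-pair p q) = c-hlam (c-happ (sound p) (c-clam (c-happ (wk-≈ (sound q)) ≈refl)))
  sound (λc-fst p) = c-hlam (c-happ (sound p) ≈refl)
  sound (λc-snd p) = c-hlam (c-happ (sound p) ≈refl)
  sound (λc-lam p) = ret-cong (c-lam (sound p))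
  sound (λc-app p q) = c-hlam (c-happ (sound p) (c-clam (c-happ (wk-≈ (sound q)) ≈refl)))
  sound (λc-βv M v) = βv-sound M v
  sound (λc-ηv v) = ηv-sound v
  sound (λc-×β₁ {V = V} {W} v w) =
    ≈trans (lv-fst-ret (`pair V W) (lv-pair-ret V W (lv-value v) (lv-value w)))
      (≈trans (ret-cong (ax-×β₁ _ _)) (≈sym (lv-value v)))
  sound (λc-×β₂ {V = V} {W} v w) =
    ≈trans (lv-snd-ret (`pair V W) (lv-pair-ret V W (lv-value v) (lv-value w)))
      (≈trans (ret-cong (ax-×β₂ _ _)) (≈sym (lv-value w)))
  sound (λc-×η {V = V} v) =
    ≈trans (lv-pair-ret (`fst V) (`snd V) (lv-fst-ret V (lv-value v)) (lv-snd-ret V (lv-value v)))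
      (≈trans (ret-cong (ax-×η _)) (≈sym (lv-value v)))
  sound (λc-1η v) = ≈trans (lv-value v) (ret-cong (ax-1η _))
  sound (λc-id M) = ≈trans (lv-let M (`var Z)) (>>=-unitʳ (lv R M))
  sound (λc-comp L M N) = comp-sound L M N
  sound (λc-let-pair M N) = ≈sym (let-pair-sound M N)
  sound (λc-let-fst M) = ≈sym (≈trans (lv-let M (`fst x₀)) (>>=-ret (lv-fst-ret x₀ ≈refl)))
  sound (λc-let-snd M) = ≈sym (≈trans (lv-let M (`snd x₀)) (>>=-ret (lv-snd-ret x₀ ≈refl)))
  sound (λc-let-app M N) = ≈sym (let-app-sound M N)

proposition4p1 : (R : CTy) {Θ : SCtx} {τ : STy} (M N : STm Θ τ)
    → M =λc N → lv R M ≈ lv R N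
proposition4p1 R M N = CPS.sound R
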